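{- Let $\times_{(R,\oplus)}$ be a product on components (under an interaction signature $(R,\oplus)$) that is commutative, associative, idempotent and monotonic. Let $A$ and $B$ be components such that $B$ is conformant to $A$ under $\times_{(R,\oplus)}$. Then, for any set of events $E$, any finite subset of the set of conformance coordinators $A\downarrow^* B=\{C\mid C\neq\mathbf{0} \text{ and } C\times_{(R,\oplus)} B\sqsubseteq A\}$ all of whose elements have interface $E$ has an upper bound with respect to the containment relation $\leq$ that is itself an element of $A\downarrow^* B$.
   Context: A timed-event stream (TES) over a set of events $E$ is an infinite sequence $\sigma$ with $\sigma(i)=(O_i,t_i)$, $i\in\mathbb{N}$, where $O_i\subseteq E$ and $t_i\in\mathbb{R}_+$, such that $t_i<t_{i+1}$ for all $i$ and for every $t\in\mathbb{R}_+$ there is $i$ with $t<t_i$. Write $\mathrm{pr}_1(\sigma)(i)=O_i$, $\mathrm{pr}_2(\sigma)(i)=t_i$; $\mathrm{TES}(E)$ is the set of all TESs over $E$. A component is a pair $C=(E,L)$ with $E$ a set of events (interface) and $L\subseteq\mathrm{TES}(E)$ (behavior); $\mathbf{0}=(\emptyset,\emptyset)$. An interaction signature $(R,\oplus)$ consists of, for sets of events $E_A,E_B$, a relation $R(E_A,E_B)\subseteq\mathrm{TES}(E_A)\times\mathrm{TES}(E_B)$ and a function $\oplus:\mathrm{TES}(E_A)\times\mathrm{TES}(E_B)\to\mathrm{TES}(E_A\cup E_B)$. The product of $A=(E_A,L_A)$ and $B=(E_B,L_B)$ is $A\times_{(R,\oplus)}B=(E_A\cup E_B,\{\sigma\oplus\tau\mid\sigma\in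 L_A,\tau\in L_B,(\sigma,\tau)\in R(E_A,E_B)\})$. Refinement: $(E_B,L_B)\sqsubseteq(E_A,L_A)$ iff $E_B\subseteq E_A$ and $L_B\subseteq L_A$. The product is commutative, associative, idempotent if $A\times B=B\times A$, $(A\times B)\times C=A\times(B\times C)$, $A\times A=A$ for all components; it is monotonic if $B\sqsubseteq A$ implies $B\times C\sqsubseteq A\times C$ for all components $A,B,C$. Containment: for TESs, $\sigma\leq\tau$ iff $\mathrm{pr}_1(\sigma)(i)\subseteq\mathrm{pr}_1(\tau)(i)$ for all $i$ and $\mathrm{pr}_2(\sigma)=\mathrm{pr}_2(\tau)$; for components, $(E_A,L_A)\leq(E_B,L_B)$ iff $E_A\subseteq E_B$ and every $\sigma\in L_A$ has some $\tau\in L_B$ with $\sigma\leq\tau$. $B$ is conformant to $A$ under the product if there exists a component $C\neq\mathbf{0}$ with $C\times_{(R,\oplus)}B\sqsubseteq A$. -}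

module Defs where

open import Level using (Lift; lift) renaming (zero to 0ℓ; suc to lsuc)
open import Data.Nat using (ℕ; suc)
open import Data.Product using (Σ; ∃; ∃-syntax; _×_; _,_; proj₁; proj₂)
open import Data.Empty using (⊥)
open import Data.List using (List)
open import Data.List.Relation.Unary.All using (All)
open import Relation.Nullary using (¬_)
open import Relation.Binary.PropositionalEquality using (_≡_)
open import Relation.Unary using (Pred; _⊆_; _∪_; ∅)

record TimeDomain : Set₁ where
  field
    Time : Set
    _<_  : Time → Time → Set

EventSet : Set → Set₁
EventSet Ev = Pred Ev 0ℓ

_≐ₑ_ : {Ev : Set} → EventSet Ev → EventSet Ev → Set
E₁ ≐ₑ E₂ = (E₁ ⊆ E₂) × (E₂ ⊆ E₁)

RawStream : TimeDomain → Set → Set₁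
RawStream 𝕋 Ev = ℕ → EventSet Ev × TimeDomain.Time 𝕋

module _ {𝕋 : TimeDomain} {Ev : Set} where
  open TimeDomain 𝕋

  pr₁ : RawStream 𝕋 Ev → ℕ → EventSet Ev
  pr₁ σ i = proj₁ (σ i)

  pr₂ : RawStream 𝕋 Ev → ℕ → Time
  pr₂ σ i = proj₂ (σ i)

  IsTES' : EventSet Ev → RawStream 𝕋 Ev → Set
  IsTES' E σ = (∀ i → pr₁ σ i ⊆ E)
            × (∀ i → pr₂ σ i < pr₂ σ (suc i))
            × (∀ (t : Time) → ∃[ i ] (t < pr₂ σ i))

  _≤ₜ_ : RawStream 𝕋 Ev → RawStream 𝕋 Ev → Set
  σ ≤ₜ τ = (∀ i → pr₁ σ i ⊆ pr₁ τ i) × (∀ i → pr₂ σ i ≡ pr₂ τ i)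

IsTES : (𝕋 : TimeDomain) {Ev : Set} → EventSet Ev → RawStream 𝕋 Ev → Set
IsTES 𝕋 = IsTES' {𝕋}

record Component (𝕋 : TimeDomain) (Ev : Set) : Set₂ where
  field
    iface : EventSet Ev
    beh   : Pred (RawStream 𝕋 Ev) (lsuc 0ℓ)
    wf    : ∀ {σ} → beh σ → IsTES 𝕋 iface σ
open Component public

record Signature (𝕋 : TimeDomain) (Ev : Set) : Set₂ where
  field
    R    : EventSet Ev → EventSet Ev → RawStream 𝕋 Ev → RawStream 𝕋 Ev → Set₁
    ⊕    : EventSet Ev → EventSet Ev → RawStream 𝕋 Ev → RawStream 𝕋 Ev → RawStream 𝕋 Ev
    ⊕-wf : ∀ {EA EB σ τ} → IsTES 𝕋 EA σ → IsTES 𝕋 EB τ → IsTES 𝕋 (EA ∪ EB) (⊕ EA EB σ τ)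
open Signature public

module _ {𝕋 : TimeDomain} {Ev : Set} where

  𝟎 : Component 𝕋 Ev
  𝟎 = record { iface = ∅ ; beh = λ _ → Lift _ ⊥ ; wf = λ { (lift ()) } }

  _≐_ : Component 𝕋 Ev → Component 𝕋 Ev → Set₁
  A ≐ B = (iface A ≐ₑ iface B) × (beh A ⊆ beh B) × (beh B ⊆ beh A)

  _⊑_ : Component 𝕋 Ev → Component 𝕋 Ev → Set₁
  B ⊑ A = (iface B ⊆ iface A) × (beh B ⊆ beh A)

  _≤_ : Component 𝕋 Ev → Component 𝕋 Ev → Set₁
  A ≤ B = (iface A ⊆ iface B)
        × (∀ {σ} → beh A σ → ∃[ τ ] (beh B τ × _≤ₜ_ {𝕋} σ τ))

  product : Signature 𝕋 Ev → Component 𝕋 Ev → Component 𝕋 Ev → Component 𝕋 Ev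
  product S A B = record
    { iface = iface A ∪ iface B
    ; beh   = λ ρ → ∃[ σ ] ∃[ τ ] (beh A σ × beh B τ
                      × R S (iface A) (iface B) σ τ
                      × ρ ≡ ⊕ S (iface A) (iface B) σ τ)
    ; wf    = λ { (σ , τ , a , b , r , _≡_.refl) → ⊕-wf S (wf A a) (wf B b) }
    }

  Commutative : Signature 𝕋 Ev → Set₂
  Commutative S = ∀ A B → product S A B ≐ product S B A

  Associative : Signature 𝕋 Ev → Set₂
  Associative S = ∀ A B C → product S (product S A B) C ≐ product S A (product S B C)

  Idempotent : Signature 𝕋 Ev → Set₂
  Idempotent S = ∀ A → product S A A ≐ A

  Monotonic : Signature 𝕋 Ev → Set₂
  Monotonic S = ∀ A B C → B ⊑ A → product S B C ⊑ product S A C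

  Coordinator : Signature 𝕋 Ev → Component 𝕋 Ev → Component 𝕋 Ev → Component 𝕋 Ev → Set₁
  Coordinator S A B C = (¬ (C ≐ 𝟎)) × (product S C B ⊑ A)

  Conformant : Signature 𝕋 Ev → Component 𝕋 Ev → Component 𝕋 Ev → Set₂
  Conformant S A B = ∃[ C ] Coordinator S A B C

-- Re-read every coordinator Cᵢ with the common interface E; monotonicity of
-- the product turns Cᵢ × B ⊑ A into (E, L_Cᵢ) × B ⊑ A, because (E, L_Cᵢ) ⊑ Cᵢ.
-- Hence every run of the union (E, ⋃ L_Cᵢ) is an admissible partner of B, so
-- the union is a coordinator; it refines, hence contains, every Cᵢ.  For the
-- empty family conformance supplies the coordinator.
module Submission where

open import Defs
open import Level using (Level; Lift; lift) renaming (suc to lsuc; zero to 0ℓ)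
open import Data.Empty using (⊥)
open import Data.Product using (∃-syntax; _×_; _,_; proj₁; proj₂)
open import Data.Sum using (_⊎_; inj₁; inj₂; [_,_])
open import Data.List using (List; []; _∷_)
open import Data.List.Relation.Unary.All using (All; []; _∷_)
import Data.List.Relation.Unary.All as All
open import Function using (_∘_; id)
open import Relation.Nullary using (¬_)
open import Relation.Binary.PropositionalEquality using (refl)
open import Relation.Unary using (Pred; _⊆_)

module _ {𝕋 : TimeDomain} {Ev : Set} where

  ≤ₜ-refl : (σ : RawStream 𝕋 Ev) → _≤ₜ_ {𝕋} σ σ
  ≤ₜ-refl σ = (λ _ → id) , (λ _ → refl)

  ⊑⇒≤ : {C D : Component 𝕋 Ev} → C ⊑ D → C ≤ D
  ⊑⇒≤ (E⊆ , L⊆) = E⊆ , λ {σ} b → σ , L⊆ b , ≤ₜ-refl σ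

  ≉𝟎-⊑ : {C D : Component 𝕋 Ev} → C ⊑ D → ¬ (C ≐ 𝟎) → ¬ (D ≐ 𝟎)
  ≉𝟎-⊑ (E⊆ , L⊆) C≉𝟎 ((D⊆∅ , _) , D→𝟎 , _) =
    C≉𝟎 ((D⊆∅ ∘ E⊆ , λ ()) , D→𝟎 ∘ L⊆ , λ { (lift ()) })

  IsTES-⊆ : {E E′ : EventSet Ev} {σ : RawStream 𝕋 Ev}
          → E ⊆ E′ → IsTES 𝕋 E σ → IsTES 𝕋 E′ σ
  IsTES-⊆ E⊆E′ (O⊆E , increasing , unbounded) = (λ i → E⊆E′ ∘ O⊆E i) , increasing , unbounded

  withIface : (C : Component 𝕋 Ev) {E : EventSet Ev} → iface C ⊆ E → Component 𝕋 Ev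
  withIface C {E} C⊆E = record { iface = E ; beh = beh C ; wf = IsTES-⊆ C⊆E ∘ wf C }

  withIface-⊑ : (C : Component 𝕋 Ev) {E : EventSet Ev} (C≐E : iface C ≐ₑ E)
              → withIface C (proj₁ C≐E) ⊑ C
  withIface-⊑ C (_ , E⊆C) = E⊆C , id

  ⋃ᵇ : List (Component 𝕋 Ev) → Pred (RawStream 𝕋 Ev) (lsuc 0ℓ)
  ⋃ᵇ []       σ = Lift _ ⊥
  ⋃ᵇ (C ∷ Cs) σ = beh C σ ⊎ ⋃ᵇ Cs σ

  ⋃ᵇ-intro : (Cs : List (Component 𝕋 Ev)) → All (λ C → beh C ⊆ ⋃ᵇ Cs) Cs
  ⋃ᵇ-intro []       = []
  ⋃ᵇ-intro (C ∷ Cs) = inj₁ ∷ All.map (λ L⊆ {σ} b → inj₂ (L⊆ b)) (⋃ᵇ-intro Cs)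

  ⋃ᵇ-elim : {ℓ : Level} {X : Pred (RawStream 𝕋 Ev) ℓ} {Cs : List (Component 𝕋 Ev)}
          → All (λ C → beh C ⊆ X) Cs → ⋃ᵇ Cs ⊆ X
  ⋃ᵇ-elim []           (lift ())
  ⋃ᵇ-elim (L⊆X ∷ Ls⊆X) = [ L⊆X , ⋃ᵇ-elim Ls⊆X ]

  ⋃ : (E : EventSet Ev) (Cs : List (Component 𝕋 Ev))
    → All (λ C → iface C ⊆ E) Cs → Component 𝕋 Ev
  ⋃ E Cs Cs⊆E = record
    { iface = E
    ; beh   = ⋃ᵇ Cs
    ; wf    = ⋃ᵇ-elim (All.map (λ {C} → wf-⊆ C) Cs⊆E)
    }
    where
    wf-⊆ : (C : Component 𝕋 Ev) → iface C ⊆ E → beh C ⊆ IsTES 𝕋 E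
    wf-⊆ C C⊆E b = IsTES-⊆ C⊆E (wf C b)

  ⋃-upper : (E : EventSet Ev) (Cs : List (Component 𝕋 Ev)) (Cs⊆E : All (λ C → iface C ⊆ E) Cs)
          → All (λ C → C ⊑ ⋃ E Cs Cs⊆E) Cs
  ⋃-upper E Cs Cs⊆E = All.zip (Cs⊆E , ⋃ᵇ-intro Cs)

  module _ (S : Signature 𝕋 Ev) (A B : Component 𝕋 Ev) where

    Admissible : EventSet Ev → Pred (RawStream 𝕋 Ev) (lsuc 0ℓ)
    Admissible E σ = ∀ {τ} → beh B τ → R S E (iface B) σ τ → beh A (⊕ S E (iface B) σ τ)

    product-⊆⇒admissible : (C : Component 𝕋 Ev)
                         → beh (product S C B) ⊆ beh A → beh C ⊆ Admissible (iface C)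
    product-⊆⇒admissible C CB⊆A {σ} b {τ} bB r = CB⊆A (σ , τ , b , bB , r , refl)

    admissible⇒product-⊆ : (C : Component 𝕋 Ev)
                         → beh C ⊆ Admissible (iface C) → beh (product S C B) ⊆ beh A
    admissible⇒product-⊆ C L⊆adm (σ , τ , b , bB , r , refl) = L⊆adm b bB r

    withIface-product-⊑ : Monotonic S → (C : Component 𝕋 Ev) {E : EventSet Ev}
                        → product S C B ⊑ A → (C≐E : iface C ≐ₑ E)
                        → product S (withIface C (proj₁ C≐E)) B ⊑ A
    withIface-product-⊑ mono C CB⊑A C≐E with mono C (withIface C (proj₁ C≐E)) B (withIface-⊑ C C≐E)
    ... | (E⊆ , L⊆) = proj₁ CB⊑A ∘ E⊆ , proj₂ CB⊑A ∘ L⊆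

    coordinator-admissible : Monotonic S → (C : Component 𝕋 Ev) {E : EventSet Ev}
                           → Coordinator S A B C × (iface C ≐ₑ E) → beh C ⊆ Admissible E
    coordinator-admissible mono C ((_ , CB⊑A) , C≐E) =
      product-⊆⇒admissible (withIface C (proj₁ C≐E))
        (proj₂ (withIface-product-⊑ mono C CB⊑A C≐E))

theorem2 : (𝕋 : TimeDomain) (Ev : Set) (S : Signature 𝕋 Ev)
    → Commutative S → Associative S → Idempotent S → Monotonic S
    → (A B : Component 𝕋 Ev) → Conformant S A B
    → (E : EventSet Ev) (Cs : List (Component 𝕋 Ev))
    → All (λ C → Coordinator S A B C × (iface C ≐ₑ E)) Cs
    → ∃[ D ] (Coordinator S A B D × All (λ C → C ≤ D) Cs)
theorem2 𝕋 Ev S _ _ _ mono A B (C₀ , coord₀) E [] [] = C₀ , coord₀ , []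
theorem2 𝕋 Ev S _ _ _ mono A B _ E Cs@(C ∷ _) coords@(((C≉𝟎 , CB⊑A) , C≐E) ∷ _) =
  D , (D≉𝟎 , DB-iface , admissible⇒product-⊆ S A B D D-admissible) , Cs≤D
  where
  Cs⊆E : All (λ C → iface C ⊆ E) Cs
  Cs⊆E = All.map (proj₁ ∘ proj₂) coords

  D : Component 𝕋 Ev
  D = ⋃ E Cs Cs⊆E

  Cs⊑D : All (λ C′ → C′ ⊑ D) Cs
  Cs⊑D = ⋃-upper E Cs Cs⊆E

  Cs≤D : All (λ C′ → C′ ≤ D) Cs
  Cs≤D = All.map (λ {C′} → ⊑⇒≤ {C = C′} {D = D}) Cs⊑D

  D≉𝟎 : ¬ (D ≐ 𝟎)
  D≉𝟎 = ≉𝟎-⊑ {C = C} {D = D} (All.head Cs⊑D) C≉𝟎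

  DB-iface : iface (product S D B) ⊆ iface A
  DB-iface = proj₁ (withIface-product-⊑ S A B mono C CB⊑A C≐E)

  D-admissible : beh D ⊆ Admissible S A B E
  D-admissible = ⋃ᵇ-elim (All.map (λ {C′} → coordinator-admissible S A B mono C′) coords)
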